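{- For integers $2\le d\le n$ with $d$ odd, $\beta^d(n) \geq n-1$.
   Context: Two vectors $A,B\in\mathbb{R}^n$ are trivially orthogonal if for every coordinate $i\in[n]$ at least one of $A(i)$, $B(i)$ is zero; they are non-trivially orthogonal if they are orthogonal (inner product $0$) but not trivially orthogonal. For $2\le d\le n$, the trivial points of $\{0,1\}^n$ are the all-zero vector and the $n$ unit vectors, together with the all-ones vector when $d$ is odd. $\beta^d(n)$ is the minimum cardinality of a set $\mathcal{V}$ of vectors in $\{ -1,0,1\}^n$, each having exactly $d$ non-zero entries, such that every non-trivial point $A\in\{0,1\}^n$ has some $V\in\mathcal{V}$ non-trivially orthogonal to $A$. -}

module Defs where

open import Data.Nat using (ℕ; zero; suc; _%_)
open import Data.Integer using (ℤ; +_; -_; _+_; _*_)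
open import Data.Bool using (Bool; true; false; _≟_)
open import Data.Fin using (Fin)
open import Data.Vec using (Vec; []; _∷_; lookup; replicate; count; map)
open import Data.Product using (_×_; ∃)
open import Data.Sum using (_⊎_)
open import Relation.Binary.PropositionalEquality using (_≡_; _≢_)
open import Relation.Nullary using (¬_)
open import Data.List using (List)
open import Data.List.Relation.Unary.All using (All)
open import Data.List.Relation.Unary.Any using (Any)

data Tri : Set where
  neg zer pos : Tri

⟦_⟧ᵗ : Tri → ℤ
⟦ neg ⟧ᵗ = - (+ 1)
⟦ zer ⟧ᵗ = + 0
⟦ pos ⟧ᵗ = + 1

⟦_⟧ᵇ : Bool → ℤ
⟦ false ⟧ᵇ = + 0
⟦ true ⟧ᵇ = + 1

isNonZeroᵗ : Tri → Bool
isNonZeroᵗ zer = false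
isNonZeroᵗ _ = true

support : ∀ {n} → Vec Tri n → ℕ
support V = count (λ t → isNonZeroᵗ t ≟ true) V

inner : ∀ {n} → Vec Tri n → Vec Bool n → ℤ
inner [] [] = + 0
inner (v ∷ V) (a ∷ A) = ⟦ v ⟧ᵗ * ⟦ a ⟧ᵇ + inner V A

Orthogonal : ∀ {n} → Vec Tri n → Vec Bool n → Set
Orthogonal V A = inner V A ≡ + 0

TriviallyOrthogonal : ∀ {n} → Vec Tri n → Vec Bool n → Set
TriviallyOrthogonal V A = ∀ i → (lookup V i ≡ zer) ⊎ (lookup A i ≡ false)

NonTriviallyOrthogonal : ∀ {n} → Vec Tri n → Vec Bool n → Set
NonTriviallyOrthogonal V A = Orthogonal V A × ¬ TriviallyOrthogonal V A

unitVec : ∀ {n} → Fin n → Vec Bool n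
unitVec {suc n} Fin.zero = true ∷ replicate n false
unitVec {suc n} (Fin.suc i) = false ∷ unitVec i

data TrivialPoint (d n : ℕ) : Vec Bool n → Set where
  allZero : TrivialPoint d n (replicate n false)
  unit    : (i : Fin n) → TrivialPoint d n (unitVec i)
  allOne  : d % 2 ≡ 1 → TrivialPoint d n (replicate n true)

-- 𝒱 (given as a duplicate-free list) is a valid family for β^d(n):
-- each vector has exactly d non-zero entries, and every non-trivial point
-- A ∈ {0,1}^n has some V ∈ 𝒱 non-trivially orthogonal to A.
Covering : (d n : ℕ) → List (Vec Tri n) → Set
Covering d n 𝒱 =
  All (λ V → support V ≡ d) 𝒱 ×
  ((A : Vec Bool n) → ¬ TrivialPoint d n A →
     Any (λ V → NonTriviallyOrthogonal V A) 𝒱)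

-- Reduce everything mod 2. The parity of ⟨V, A⟩ is the GF(2) product of the
-- support indicator s(V) with A, so for A = 1 + y with s(V)·y = 0 it equals
-- |supp V| + s(V)·y = d + 0, which is odd: such an A is orthogonal to no V ∈ 𝒱.
-- If |𝒱| ≤ n - 2, the kernel of the |𝒱| forms s(V) contains a plane
-- {0, y₁, y₂, y₁ + y₂}; every coordinate vanishes on one of y₁, y₂, y₁ + y₂, so
-- for n ≥ 4 one of them has two zeros and its complement is a non-trivial point
-- that nothing covers. The case n = d = 3 is a direct check.
module Submission where

open import Defs
open import Algebra using (CommutativeRing)
open import Algebra.Properties.CommutativeSemigroup using (interchange)
open import Data.Bool using (Bool; true; false; not; _∧_; _xor_)
open import Data.Bool.Properties
  using (xor-same; xor-comm; not-involutive; ∧-distribˡ-xor; ∧-distribʳ-xor; xor-∧-commutativeRing)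
open import Data.Empty using (⊥; ⊥-elim)
open import Data.Fin using (Fin; zero; suc)
open import Data.Integer using (ℤ; +_; -[1+_]; _*_; _+_)
open import Data.Integer.Properties using (+-identityˡ)
open import Data.List using (List; []; _∷_; _++_; length)
import Data.List as List
open import Data.List.Properties using (length-map; length-++-sucʳ)
open import Data.List.Relation.Unary.All as All using (All; []; _∷_)
open import Data.List.Relation.Unary.All.Properties using (All¬⇒¬Any; map⁻; ++⁺; ++⁻ˡ; ++⁻ʳ)
open import Data.List.Relation.Unary.Any using (Any; here)
open import Data.List.Relation.Unary.Unique.Propositional using (Unique)
open import Data.Nat as ℕ using (ℕ; zero; suc; _≤_; _<_; _∸_; _%_; z≤n; s≤s; _≤?_)
open import Data.Nat.Properties using (≤-refl; ≤-trans; ≤-reflexive; ≤-pred; <-irrefl; ≮⇒≥; +-mono-≤; +-monoʳ-≤; +-suc; n≤1+n)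
open import Data.Product using (∃; _×_; _,_)
open import Data.Sum using (_⊎_; inj₁; inj₂)
open import Data.Vec using (Vec; []; _∷_; lookup; replicate; map; zipWith; head)
open import Data.Vec.Properties using (lookup-map; lookup-replicate; lookup-zipWith; zipWith-replicate₁)
open import Relation.Binary.PropositionalEquality
open import Relation.Nullary using (¬_; yes; no; contradiction)

open CommutativeRing xor-∧-commutativeRing using (+-commutativeSemigroup)

infixl 6 _⊕_
_⊕_ : ∀ {n} → Vec Bool n → Vec Bool n → Vec Bool n
_⊕_ = zipWith _xor_

infix 7 _·_
_·_ : ∀ {n} → Vec Bool n → Vec Bool n → Bool
[] · [] = false
(a ∷ f) · (b ∷ y) = (a ∧ b) xor (f · y)

xor-interchange : ∀ a b c d → (a xor b) xor (c xor d) ≡ (a xor c) xor (b xor d)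
xor-interchange = interchange +-commutativeSemigroup

·-distribˡ-⊕ : ∀ {n} (f y z : Vec Bool n) → f · (y ⊕ z) ≡ f · y xor f · z
·-distribˡ-⊕ [] [] [] = refl
·-distribˡ-⊕ (a ∷ f) (b ∷ y) (c ∷ z)
  rewrite ∧-distribˡ-xor a b c | ·-distribˡ-⊕ f y z = xor-interchange (a ∧ b) (a ∧ c) (f · y) (f · z)

·-distribʳ-⊕ : ∀ {n} (f g y : Vec Bool n) → (f ⊕ g) · y ≡ f · y xor g · y
·-distribʳ-⊕ [] [] [] = refl
·-distribʳ-⊕ (a ∷ f) (b ∷ g) (c ∷ y)
  rewrite ∧-distribʳ-xor c a b | ·-distribʳ-⊕ f g y = xor-interchange (a ∧ c) (b ∧ c) (f · y) (g · y)

·-zeroʳ : ∀ {n} (f : Vec Bool n) → f · replicate n false ≡ false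
·-zeroʳ [] = refl
·-zeroʳ (false ∷ f) = ·-zeroʳ f
·-zeroʳ (true ∷ f) = ·-zeroʳ f

·-zeroˡ : ∀ {n} (y : Vec Bool n) → replicate n false · y ≡ false
·-zeroˡ [] = refl
·-zeroˡ (_ ∷ y) = ·-zeroˡ y

unitVec-· : ∀ {n} (i : Fin n) (y : Vec Bool n) → unitVec i · y ≡ lookup y i
unitVec-· zero (false ∷ y) = ·-zeroˡ y
unitVec-· zero (true ∷ y) = cong not (·-zeroˡ y)
unitVec-· (suc i) (_ ∷ y) = unitVec-· i y

NonZero : ∀ {n} → Vec Bool n → Set
NonZero y = ∃ λ i → lookup y i ≡ true

Kernel : ∀ {n} → List (Vec Bool n) → Vec Bool n → Set
Kernel fs y = All (λ f → f · y ≡ false) fs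

Kernel-⊕ : ∀ {n} (fs : List (Vec Bool n)) {y z} → Kernel fs y → Kernel fs z → Kernel fs (y ⊕ z)
Kernel-⊕ [] [] [] = []
Kernel-⊕ (f ∷ fs) {y} {z} (fy ∷ ky) (fz ∷ kz) =
  trans (·-distribˡ-⊕ f y z) (cong₂ _xor_ fy fz) ∷ Kernel-⊕ fs ky kz

data PivotView {n} : List (Vec Bool (suc n)) → Set where
  no-pivot : ∀ {fs} → All (λ f → head f ≡ false) fs → PivotView fs
  pivot : ∀ pre p post → PivotView (pre ++ (true ∷ p) ∷ post)

pivotView : ∀ {n} (fs : List (Vec Bool (suc n))) → PivotView fs
pivotView [] = no-pivot []
pivotView ((true ∷ p) ∷ fs) = pivot [] p fs
pivotView ((false ∷ f) ∷ fs) with pivotView fs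
... | no-pivot heads = no-pivot (refl ∷ heads)
... | pivot pre p post = pivot ((false ∷ f) ∷ pre) p post

reduce : ∀ {n} → Vec Bool n → Vec Bool (suc n) → Vec Bool n
reduce p (false ∷ f) = f
reduce p (true ∷ f) = f ⊕ p

reduce-· : ∀ {n} (p y : Vec Bool n) (f : Vec Bool (suc n)) → reduce p f · y ≡ f · (p · y ∷ y)
reduce-· p y (false ∷ f) = refl
reduce-· p y (true ∷ f) = trans (·-distribʳ-⊕ f p y) (xor-comm (f · y) (p · y))

Kernel-pivot : ∀ {n} (p y : Vec Bool n) pre post →
  Kernel (List.map (reduce p) (pre ++ post)) y → Kernel (pre ++ (true ∷ p) ∷ post) (p · y ∷ y)
Kernel-pivot p y pre post ker = ++⁺ (++⁻ˡ pre lifted) (xor-same (p · y) ∷ ++⁻ʳ pre lifted)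
  where
  lifted : Kernel (pre ++ post) (p · y ∷ y)
  lifted = All.map (λ {f} e → trans (sym (reduce-· p y f)) e) (map⁻ ker)

Kernel-no-pivot : ∀ {n} {fs : List (Vec Bool (suc n))} →
  All (λ f → head f ≡ false) fs → Kernel fs (true ∷ replicate n false)
Kernel-no-pivot [] = []
Kernel-no-pivot {fs = (false ∷ f) ∷ _} (refl ∷ heads) = ·-zeroʳ f ∷ Kernel-no-pivot heads

-- Eliminate the first coordinate with a row whose head is 1 (the pivot); a kernel
-- vector y of the reduced rows extends to one of the original rows as p · y ∷ y.
nonzero-kernel : ∀ {n} (fs : List (Vec Bool n)) → length fs < n → ∃ λ y → NonZero y × Kernel fs y
nonzero-kernel {suc n} fs short with pivotView fs
... | no-pivot heads = true ∷ replicate n false , (zero , refl) , Kernel-no-pivot heads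
... | pivot pre p post with nonzero-kernel (List.map (reduce p) (pre ++ post)) shorter
  where
  shorter : length (List.map (reduce p) (pre ++ post)) < n
  shorter rewrite length-map (reduce p) (pre ++ post) | length-++-sucʳ pre (true ∷ p) post = ≤-pred short
...   | y , (i , yᵢ) , ker = p · y ∷ y , (suc i , yᵢ) , Kernel-pivot p y pre post ker

weight : ∀ {n} → Vec Bool n → ℕ
weight [] = 0
weight (false ∷ a) = weight a
weight (true ∷ a) = suc (weight a)

weight-complements : ∀ {n} (y z : Vec Bool n) →
  n ≤ weight (map not y) ℕ.+ weight (map not z) ℕ.+ weight (map not (y ⊕ z))
weight-complements [] [] = z≤n
weight-complements (false ∷ y) (false ∷ z) =
  s≤s (≤-trans (weight-complements y z) (+-mono-≤ (+-monoʳ-≤ (weight (map not y)) (n≤1+n _)) (n≤1+n _)))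
weight-complements (false ∷ y) (true ∷ z) = s≤s (weight-complements y z)
weight-complements (true ∷ y) (false ∷ z) =
  ≤-trans (s≤s (weight-complements y z))
          (≤-reflexive (cong (ℕ._+ weight (map not (y ⊕ z))) (sym (+-suc (weight (map not y)) _))))
weight-complements (true ∷ y) (true ∷ z) =
  ≤-trans (s≤s (weight-complements y z)) (≤-reflexive (sym (+-suc _ _)))

two-≤-one-of : ∀ a b c → 4 ≤ a ℕ.+ b ℕ.+ c → 2 ≤ a ⊎ 2 ≤ b ⊎ 2 ≤ c
two-≤-one-of a b c sum≥4 with 2 ≤? a | 2 ≤? b | 2 ≤? c
... | yes a≥2 | _ | _ = inj₁ a≥2
... | no _ | yes b≥2 | _ = inj₂ (inj₁ b≥2)
... | no _ | no _ | yes c≥2 = inj₂ (inj₂ c≥2)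
... | no a≱2 | no b≱2 | no c≱2 =
  ⊥-elim (<-irrefl refl (≤-trans sum≥4 (+-mono-≤ (+-mono-≤ (≮⇒≥ a≱2) (≮⇒≥ b≱2)) (≮⇒≥ c≱2))))

kernel-vector-with-two-zeros : ∀ {n} (fs : List (Vec Bool n)) → 4 ≤ n → 2 ℕ.+ length fs ≤ n →
  ∃ λ y → NonZero y × Kernel fs y × 2 ≤ weight (map not y)
kernel-vector-with-two-zeros {n} fs n≥4 short with nonzero-kernel fs (≤-trans (n≤1+n _) short)
... | y , (i , yᵢ) , ker-y with nonzero-kernel (unitVec i ∷ fs) short
...   | z , z≢0 , zᵢ ∷ ker-z with two-≤-one-of _ _ _ (≤-trans n≥4 (weight-complements y z))
...     | inj₁ two = y , (i , yᵢ) , ker-y , two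
...     | inj₂ (inj₁ two) = z , z≢0 , ker-z , two
...     | inj₂ (inj₂ two) = y ⊕ z , (i , y⊕zᵢ) , Kernel-⊕ fs ker-y ker-z , two
  where
  y⊕zᵢ : lookup (y ⊕ z) i ≡ true
  y⊕zᵢ = trans (lookup-zipWith _xor_ i y z) (cong₂ _xor_ yᵢ (trans (sym (unitVec-· i z)) zᵢ))

weight-replicate-false : ∀ n → weight (replicate n false) ≡ 0
weight-replicate-false zero = refl
weight-replicate-false (suc n) = weight-replicate-false n

weight-unitVec : ∀ {n} (i : Fin n) → weight (unitVec i) ≡ 1
weight-unitVec {suc n} zero = cong suc (weight-replicate-false n)
weight-unitVec (suc i) = weight-unitVec i

trivial-weight : ∀ {d n A} → TrivialPoint d n A → weight A ≤ 1 ⊎ A ≡ replicate n true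
trivial-weight {n = n} allZero = inj₁ (≤-trans (≤-reflexive (weight-replicate-false n)) z≤n)
trivial-weight (unit i) = inj₁ (≤-reflexive (weight-unitVec i))
trivial-weight (allOne _) = inj₂ refl

nontrivial : ∀ {d n A} → 2 ≤ weight A → A ≢ replicate n true → ¬ TrivialPoint d n A
nontrivial two A≢1 t with trivial-weight t
... | inj₁ one = <-irrefl refl (≤-trans two one)
... | inj₂ A≡1 = A≢1 A≡1

complement-≢-ones : ∀ {n} {y : Vec Bool n} → NonZero y → map not y ≢ replicate n true
complement-≢-ones {y = y} (i , yᵢ) e = contradiction (trans (cong not (sym yᵢ)) not-yᵢ) λ ()
  where
  not-yᵢ : not (lookup y i) ≡ true
  not-yᵢ = trans (sym (lookup-map i not y)) (trans (cong (λ v → lookup v i) e) (lookup-replicate i true))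

parityℕ : ℕ → Bool
parityℕ zero = false
parityℕ (suc n) = not (parityℕ n)

parity : ℤ → Bool
parity (+ n) = parityℕ n
parity -[1+ n ] = not (parityℕ n)

parity-1+ : ∀ z → parity (+ 1 + z) ≡ not (parity z)
parity-1+ (+ n) = refl
parity-1+ -[1+ zero ] = refl
parity-1+ -[1+ suc n ] = sym (not-involutive _)

parity-¯1+ : ∀ z → parity (-[1+ 0 ] + z) ≡ not (parity z)
parity-¯1+ (+ zero) = refl
parity-¯1+ (+ suc n) = sym (not-involutive _)
parity-¯1+ -[1+ n ] = refl

parity-step : ∀ v a z → parity (⟦ v ⟧ᵗ * ⟦ a ⟧ᵇ + z) ≡ (isNonZeroᵗ v ∧ a) xor parity z
parity-step zer a z = cong parity (+-identityˡ z)
parity-step neg false z = cong parity (+-identityˡ z)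
parity-step pos false z = cong parity (+-identityˡ z)
parity-step neg true z = parity-¯1+ z
parity-step pos true z = parity-1+ z

supportVector : ∀ {n} → Vec Tri n → Vec Bool n
supportVector = map isNonZeroᵗ

parity-inner : ∀ {n} (V : Vec Tri n) (A : Vec Bool n) → parity (inner V A) ≡ supportVector V · A
parity-inner [] [] = refl
parity-inner (v ∷ V) (a ∷ A) =
  trans (parity-step v a (inner V A)) (cong ((isNonZeroᵗ v ∧ a) xor_) (parity-inner V A))

supportVector-·-ones : ∀ {n} (V : Vec Tri n) → supportVector V · replicate n true ≡ parityℕ (support V)
supportVector-·-ones [] = refl
supportVector-·-ones (neg ∷ V) = cong not (supportVector-·-ones V)
supportVector-·-ones (zer ∷ V) = supportVector-·-ones V
supportVector-·-ones (pos ∷ V) = cong not (supportVector-·-ones V)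

odd-parity : ∀ {d} → d % 2 ≡ 1 → parityℕ d ≡ true
odd-parity {suc zero} _ = refl
odd-parity {suc (suc d)} odd = cong (λ b → not (not b)) (odd-parity {d} odd)

not-orthogonal-to-complement : ∀ {n} (V : Vec Tri n) {y : Vec Bool n} →
  parityℕ (support V) ≡ true → supportVector V · y ≡ false → ¬ Orthogonal V (map not y)
not-orthogonal-to-complement {n} V {y} odd ker orth = contradiction (begin
  false                                                      ≡⟨ cong parity (sym orth) ⟩
  parity (inner V (map not y))                               ≡⟨ parity-inner V (map not y) ⟩
  s · map not y                                              ≡⟨ cong (s ·_) (sym (zipWith-replicate₁ _xor_ true y)) ⟩
  s · (replicate n true ⊕ y)                                 ≡⟨ ·-distribˡ-⊕ s (replicate n true) y ⟩
  s · replicate n true xor s · y                             ≡⟨ cong₂ _xor_ (trans (supportVector-·-ones V) odd) ker ⟩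
  true                                                       ∎) λ ()
  where
  open ≡-Reasoning
  s = supportVector V

complement-uncovered : ∀ {d n} {𝒱 : List (Vec Tri n)} {y : Vec Bool n} →
  All (λ V → support V ≡ d) 𝒱 → parityℕ d ≡ true → Kernel (List.map supportVector 𝒱) y →
  ¬ Any (λ V → NonTriviallyOrthogonal V (map not y)) 𝒱
complement-uncovered sized odd ker = All¬⇒¬Any (All.zipWith
  (λ { {V} (|V|≡d , Vy≡0) (orth , _) → not-orthogonal-to-complement V (trans (cong parityℕ |V|≡d) odd) Vy≡0 orth })
  (sized , map⁻ ker))

no-small-covering-from-dim-4 : ∀ {d n} (𝒱 : List (Vec Tri n)) → parityℕ d ≡ true → Covering d n 𝒱 →
  4 ≤ n → 2 ℕ.+ length 𝒱 ≤ n → ⊥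
no-small-covering-from-dim-4 {n = n} 𝒱 odd (sized , covers) n≥4 short
  with kernel-vector-with-two-zeros (List.map supportVector 𝒱) n≥4
         (subst (λ m → 2 ℕ.+ m ≤ n) (sym (length-map supportVector 𝒱)) short)
... | y , y≢0 , ker , two =
  complement-uncovered sized odd ker (covers (map not y) (nontrivial two (complement-≢-ones y≢0)))

-- Each weight-two point forces two opposite non-zero entries of V, and three
-- pairwise opposite signs do not exist.
no-vector-orthogonal-to-all-pairs : (V : Vec Tri 3) →
  NonTriviallyOrthogonal V (true ∷ true ∷ false ∷ []) →
  NonTriviallyOrthogonal V (true ∷ false ∷ true ∷ []) →
  NonTriviallyOrthogonal V (false ∷ true ∷ true ∷ []) → ⊥
no-vector-orthogonal-to-all-pairs (neg ∷ neg ∷ neg ∷ []) (() , _) _ _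
no-vector-orthogonal-to-all-pairs (neg ∷ neg ∷ zer ∷ []) (() , _) _ _
no-vector-orthogonal-to-all-pairs (neg ∷ neg ∷ pos ∷ []) (() , _) _ _
no-vector-orthogonal-to-all-pairs (neg ∷ zer ∷ neg ∷ []) (() , _) _ _
no-vector-orthogonal-to-all-pairs (neg ∷ zer ∷ zer ∷ []) (() , _) _ _
no-vector-orthogonal-to-all-pairs (neg ∷ zer ∷ pos ∷ []) (() , _) _ _
no-vector-orthogonal-to-all-pairs (neg ∷ pos ∷ neg ∷ []) _ (() , _) _
no-vector-orthogonal-to-all-pairs (neg ∷ pos ∷ zer ∷ []) _ (() , _) _
no-vector-orthogonal-to-all-pairs (neg ∷ pos ∷ pos ∷ []) _ _ (() , _)
no-vector-orthogonal-to-all-pairs (zer ∷ neg ∷ neg ∷ []) (() , _) _ _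
no-vector-orthogonal-to-all-pairs (zer ∷ neg ∷ zer ∷ []) (() , _) _ _
no-vector-orthogonal-to-all-pairs (zer ∷ neg ∷ pos ∷ []) (() , _) _ _
no-vector-orthogonal-to-all-pairs (zer ∷ zer ∷ neg ∷ []) (_ , nt) _ _ = nt (λ { zero → inj₁ refl ; (suc zero) → inj₁ refl ; (suc (suc zero)) → inj₂ refl })
no-vector-orthogonal-to-all-pairs (zer ∷ zer ∷ zer ∷ []) (_ , nt) _ _ = nt (λ { zero → inj₁ refl ; (suc zero) → inj₁ refl ; (suc (suc zero)) → inj₁ refl })
no-vector-orthogonal-to-all-pairs (zer ∷ zer ∷ pos ∷ []) (_ , nt) _ _ = nt (λ { zero → inj₁ refl ; (suc zero) → inj₁ refl ; (suc (suc zero)) → inj₂ refl })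
no-vector-orthogonal-to-all-pairs (zer ∷ pos ∷ neg ∷ []) (() , _) _ _
no-vector-orthogonal-to-all-pairs (zer ∷ pos ∷ zer ∷ []) (() , _) _ _
no-vector-orthogonal-to-all-pairs (zer ∷ pos ∷ pos ∷ []) (() , _) _ _
no-vector-orthogonal-to-all-pairs (pos ∷ neg ∷ neg ∷ []) _ _ (() , _)
no-vector-orthogonal-to-all-pairs (pos ∷ neg ∷ zer ∷ []) _ (() , _) _
no-vector-orthogonal-to-all-pairs (pos ∷ neg ∷ pos ∷ []) _ (() , _) _
no-vector-orthogonal-to-all-pairs (pos ∷ zer ∷ neg ∷ []) (() , _) _ _
no-vector-orthogonal-to-all-pairs (pos ∷ zer ∷ zer ∷ []) (() , _) _ _
no-vector-orthogonal-to-all-pairs (pos ∷ zer ∷ pos ∷ []) (() , _) _ _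
no-vector-orthogonal-to-all-pairs (pos ∷ pos ∷ neg ∷ []) (() , _) _ _
no-vector-orthogonal-to-all-pairs (pos ∷ pos ∷ zer ∷ []) (() , _) _ _
no-vector-orthogonal-to-all-pairs (pos ∷ pos ∷ pos ∷ []) (() , _) _ _

no-small-covering-in-dim-3 : ∀ {d} (𝒱 : List (Vec Tri 3)) → Covering d 3 𝒱 → length 𝒱 < 2 → ⊥
no-small-covering-in-dim-3 [] (_ , covers) _ with covers (true ∷ true ∷ false ∷ []) (nontrivial ≤-refl λ ())
... | ()
no-small-covering-in-dim-3 (V ∷ []) (_ , covers) _
  with covers (true ∷ true ∷ false ∷ []) (nontrivial ≤-refl λ ())
     | covers (true ∷ false ∷ true ∷ []) (nontrivial ≤-refl λ ())
     | covers (false ∷ true ∷ true ∷ []) (nontrivial ≤-refl λ ())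
... | here a | here b | here c = no-vector-orthogonal-to-all-pairs V a b c
no-small-covering-in-dim-3 (_ ∷ _ ∷ _) _ (s≤s (s≤s ()))

odd-≥3 : ∀ {d} → 2 ≤ d → d % 2 ≡ 1 → 3 ≤ d
odd-≥3 {suc zero} (s≤s ()) _
odd-≥3 {suc (suc zero)} _ ()
odd-≥3 {suc (suc (suc _))} _ _ = s≤s (s≤s (s≤s z≤n))

no-small-covering : ∀ {d} n → 3 ≤ n → parityℕ d ≡ true →
  (𝒱 : List (Vec Tri n)) → Covering d n 𝒱 → length 𝒱 < n ∸ 1 → ⊥
no-small-covering 2 (s≤s (s≤s ()))
no-small-covering 3 _ _ 𝒱 cov short = no-small-covering-in-dim-3 𝒱 cov short
no-small-covering {d} (suc (suc (suc (suc _)))) _ odd 𝒱 cov short =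
  no-small-covering-from-dim-4 {d} 𝒱 odd cov (s≤s (s≤s (s≤s (s≤s z≤n)))) (s≤s short)

lemma1 : (d n : ℕ) → 2 ≤ d → d ≤ n → d % 2 ≡ 1 →
    (𝒱 : List (Vec Tri n)) → Unique 𝒱 → Covering d n 𝒱 →
    n ∸ 1 ≤ length 𝒱
lemma1 d n 2≤d d≤n odd 𝒱 _ cov =
  ≮⇒≥ (no-small-covering {d} n (≤-trans (odd-≥3 2≤d odd) d≤n) (odd-parity {d} odd) 𝒱 cov)
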